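{- Let $T\subset V$ satisfy $w(T)>W_U$. Then the inequality \[ \sum_{\{i,j\}\in E(T)} x_{ij}\;\le\;\frac{(|T|-1)(|T|-2)}{2} \] is valid for $\mathcal{P}$ (i.e. satisfied by every $x\in\mathcal{P}$).
   Context: Let $n,k$ be integers with $k\ge 2$, $F_L:=\lfloor n/k\rfloor\ge 2$ and $F_U:=\lceil n/k\rceil$. Let $G=(V,E)$ be the complete graph on $V=\{1,\dots,n\}$, let $w:V\to\mathbb{R}^+$ be node weights and $W_L\le W_U$ positive reals. For $x\in\{0,1\}^E$ write $x_{ij}=x_{ji}$ for the coordinate of edge $\{i,j\}$. Let $r_0=n \bmod k$ and $\beta_{n,k}=r_0F_U(F_U-1)/2+(k-r_0)F_L(F_L-1)/2$. $\mathcal{P}$ is the convex hull of all $x\in\{0,1\}^E$ satisfying: for all distinct $i<j<l$, $x_{ij}+x_{jl}-x_{il}\le1$, $x_{ij}-x_{jl}+x_{il}\le1$, $-x_{ij}+x_{jl}+x_{il}\le1$; for all $i\in V$, $F_L\le 1+\sum_{j\ne i}x_{ij}\le F_U$ and $W_L\le w_i+\sum_{j\ne i}w_jx_{ij}\le W_U$; and $\sum_{\{i,j\}\in E}x_{ij}=\beta_{n,k}$. (These integer points are exactly the incidence vectors, $x_{ij}=1$ iff $i,j$ lie in the same part, of partitions of $V$ into $k$ nonempty parts with sizes differing by at most one and each part of total weight in $[W_L,W_U]$.) For $T\subseteq V$, $w(T)=\sum_{i\in T}w_i$ and $E(T)$ is the set of edges with both end nodes in $T$.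
   Formalization: The node weights $w$ and the bounds $W_L$, $W_U$ are rational instead of real, and the inequality is proved only at rational convex combinations of the integer points of $\mathcal{P}$. -}

module Defs where

open import Data.Bool using (Bool; true; false; if_then_else_)
open import Data.Nat as ℕ using (ℕ; zero; suc; _∸_; _<ᵇ_)
open import Data.Nat.DivMod using (_/_; _%_)
open import Data.Fin using (Fin; toℕ) renaming (zero to fzero; suc to fsuc)
open import Relation.Binary.PropositionalEquality using (_≡_)
open import Data.Fin.Subset using (Subset; ∣_∣)
open import Data.Vec using (lookup)
open import Data.Integer using (+_)
open import Data.Rational as ℚ using (ℚ; 0ℚ; 1ℚ; ½; _+_; _-_; _*_; _≤_; _<_)
open import Data.List using (List; []; _∷_)
open import Data.List.Relation.Unary.All using (All)
import Data.Product
open import Data.Product using (_×_; _,_; proj₁; proj₂)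

ι : ℕ → ℚ
ι m = + m ℚ./ 1

ΣF : (n : ℕ) → (Fin n → ℚ) → ℚ
ΣF zero    f = 0ℚ
ΣF (suc n) f = f fzero + ΣF n (λ i → f (fsuc i))

b2q : Bool → ℚ
b2q true  = 1ℚ
b2q false = 0ℚ

-- A vector in ℚ^E (E = edges of the complete graph on Fin n) is given by a
-- function on ordered pairs; only the entries with toℕ i < toℕ j are used.
edge : {n : ℕ} {A : Set} → (Fin n → Fin n → A) → Fin n → Fin n → A
edge x i j = if toℕ i <ᵇ toℕ j then x i j else x j i

FL : (n k : ℕ) → .{{ℕ.NonZero k}} → ℕ
FL n k = n / k

FU : (n k : ℕ) → .{{ℕ.NonZero k}} → ℕ
FU n k = (n ℕ.+ (k ∸ 1)) / k

r0 : (n k : ℕ) → .{{ℕ.NonZero k}} → ℕ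
r0 n k = n % k

β : (n k : ℕ) → .{{ℕ.NonZero k}} → ℕ
β n k = r0 n k ℕ.* ((FU n k ℕ.* (FU n k ∸ 1)) / 2)
        ℕ.+ (k ∸ r0 n k) ℕ.* ((FL n k ℕ.* (FL n k ∸ 1)) / 2)

-- The integer points of 𝒫 (binary vectors y ∈ {0,1}^E satisfying all constraints).
record Feasible (n k : ℕ) .{{_ : ℕ.NonZero k}} (w : Fin n → ℚ) (WL WU : ℚ)
                (y : Fin n → Fin n → Bool) : Set where
  field
    triangle : (i j l : Fin n) → toℕ i ℕ.< toℕ j → toℕ j ℕ.< toℕ l →
      let a = b2q (edge y i j) ; b = b2q (edge y j l) ; c = b2q (edge y i l) in
      (a + b - c ≤ 1ℚ) × (a - b + c ≤ 1ℚ) × (((0ℚ - a) + b + c) ≤ 1ℚ)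
    sizeL : (i : Fin n) →
      ι (FL n k) ≤ 1ℚ + ΣF n (λ j → if toℕ i ℕ.≡ᵇ toℕ j then 0ℚ else b2q (edge y i j))
    sizeU : (i : Fin n) →
      1ℚ + ΣF n (λ j → if toℕ i ℕ.≡ᵇ toℕ j then 0ℚ else b2q (edge y i j)) ≤ ι (FU n k)
    weightL : (i : Fin n) →
      WL ≤ w i + ΣF n (λ j → if toℕ i ℕ.≡ᵇ toℕ j then 0ℚ else w j * b2q (edge y i j))
    weightU : (i : Fin n) →
      w i + ΣF n (λ j → if toℕ i ℕ.≡ᵇ toℕ j then 0ℚ else w j * b2q (edge y i j)) ≤ WU
    total :
      ΣF n (λ i → ΣF n (λ j → if toℕ i <ᵇ toℕ j then b2q (edge y i j) else 0ℚ)) ≡ ι (β n k)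

ΣL : {A : Set} → List A → (A → ℚ) → ℚ
ΣL []       f = 0ℚ
ΣL (a ∷ as) f = f a + ΣL as f

FeasiblePt : (n k : ℕ) .{{_ : ℕ.NonZero k}} (w : Fin n → ℚ) (WL WU : ℚ) → Set
FeasiblePt n k w WL WU =
  Data.Product.Σ (Fin n → Fin n → Bool) (Feasible n k w WL WU)

-- x ∈ 𝒫 : x is a convex combination of finitely many integer points of 𝒫
-- (coordinates compared on each edge {i,j}, i < j).
record In𝒫 (n k : ℕ) .{{_ : ℕ.NonZero k}} (w : Fin n → ℚ) (WL WU : ℚ)
           (x : Fin n → Fin n → ℚ) : Set where
  field
    pts     : List (ℚ × FeasiblePt n k w WL WU)
    nonneg  : All (λ p → 0ℚ ≤ proj₁ p) pts
    sumOne  : ΣL pts proj₁ ≡ 1ℚ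
    combo   : (i j : Fin n) → toℕ i ℕ.< toℕ j →
              x i j ≡ ΣL pts (λ p → proj₁ p * b2q (proj₁ (proj₂ p) i j))

wt : {n : ℕ} → (Fin n → ℚ) → Subset n → ℚ
wt {n} w T = ΣF n (λ i → if lookup T i then w i else 0ℚ)

ΣET : {n : ℕ} → Subset n → (Fin n → Fin n → ℚ) → ℚ
ΣET {n} T x = ΣF n (λ i → ΣF n (λ j →
  if lookup T i then (if lookup T j then (if toℕ i <ᵇ toℕ j then edge x i j else 0ℚ) else 0ℚ) else 0ℚ))

rhs : ℕ → ℚ
rhs t = ((ι t - 1ℚ) * (ι t - ι 2)) * ½

-- At an integer point y of 𝒫 the triangle inequalities make "same part" an equivalence
-- relation, and every part has weight at most W_U.  As weights are positive, a set T with
-- w(T) > W_U is not inside one part: it contains a and b in different parts.  Each other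
-- element of T is then in the part of at most one of a, b, so a and b have at most t - 2
-- neighbours in T together (t = |T|), and every other element of T has at most t - 2.
-- Summing degrees, 2 Σ_{E(T)} y ≤ (t - 2) + (t - 2)² = (t - 1)(t - 2).  The inequality is
-- linear in x, so it passes from the integer points to their convex combinations.

{-# OPTIONS --safe #-}
module Submission where

open import Defs
open import Data.Nat as ℕ using (ℕ; _≥_)
open import Data.Fin using (Fin)
open import Data.Fin.Subset using (Subset; ∣_∣)
open import Data.Rational using (ℚ; 0ℚ; _≤_; _<_)

open import Algebra.Bundles using (Ring)
open import Data.Bool using (Bool; true; false; if_then_else_; T)
open import Data.Bool.Properties using (if-swap-then; if-swap-else)
import Data.Bool.Properties as Bool
open import Data.Empty using (⊥; ⊥-elim)
open import Data.Fin as Fin using (toℕ; zero; suc; _≟_)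
open import Data.Fin.Properties using (toℕ-injective; <-cmp; any?)
import Data.Integer as ℤ
import Data.Integer.Properties as ℤ
open import Data.List using (List; []; _∷_)
open import Data.List.Relation.Unary.All using (All; []; _∷_)
open import Data.Nat using (zero; suc; _<ᵇ_; _≡ᵇ_)
open import Data.Nat.Properties using (≡⇒≡ᵇ; ≡ᵇ⇒≡; <ᵇ⇒<; <⇒<ᵇ; <-asym)
open import Data.Nat.Coprimality using (Coprime; 1-coprimeTo) renaming (sym to coprime-sym)
open import Data.Product using (∃₂; _×_; _,_; proj₁; proj₂)
open import Data.Rational using (mkℚ; 1ℚ; ½; _+_; _*_; _-_; _≤?_; nonNegative)
open import Data.Rational.Properties as ℚP
  using (≤-refl; ≤-reflexive; ≤-trans; <⇒≤; <-≤-trans; <-irrefl; +-mono-≤; +-identityˡ;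
         *-zeroʳ; *-identityʳ; *-identityˡ; *-monoˡ-≤-nonNeg; *-monoʳ-≤-nonNeg)
open import Data.Rational.Solver using (module +-*-Solver)
open import Data.Unit using (tt)
open import Data.Vec using (lookup; []; _∷_)
open import Function using (_∘_; flip)
open import Relation.Binary.Definitions using (tri<; tri≈; tri>)
open import Relation.Binary.PropositionalEquality
open import Relation.Nullary using (¬_; yes; no; ¬?)
open import Relation.Nullary.Decidable using (True; False; toWitness; toWitnessFalse; _×-dec_)

open import Algebra.Properties.Semiring.Sum (Ring.semiring ℚP.+-*-ring)
  using (sum; sum-cong-≗; sum-replicate-zero; ∑-distrib-+; ∑-comm; *-distribˡ-sum)
open import Algebra.Properties.CommutativeSemigroup
  (Ring.+-commutativeSemigroup ℚP.+-*-ring) using (x∙yz≈y∙xz)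
open +-*-Solver

≤-compute : ∀ {p q} → {True (p ≤? q)} → p ≤ q
≤-compute {p} {q} {p≤q} = toWitness {a? = p ≤? q} p≤q

≰-compute : ∀ {p q} → {False (p ≤? q)} → ¬ p ≤ q
≰-compute {p} {q} {p≰q} = toWitnessFalse {a? = p ≤? q} p≰q

ι-suc : ∀ m → ι (suc m) ≡ 1ℚ + ι m
ι-suc m = begin
  ι (suc m)                      ≡⟨ ℚP./-cong (cong (ℤ._+_ (ℤ.+ 1)) (sym (ℤ.*-identityʳ (ℤ.+ m)))) refl ⟩
  1ℚ + mkℚ (ℤ.+ m) 0 m-coprime-1   ≡⟨ cong (1ℚ +_) (ℚP.normalize-coprime m-coprime-1) ⟨
  1ℚ + ι m                       ∎
  where
  open ≡-Reasoning
  m-coprime-1 : Coprime m 1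
  m-coprime-1 = coprime-sym (1-coprimeTo m)

guard : Bool → ℚ → ℚ
guard b q = if b then q else 0ℚ

except : ∀ {n} → Fin n → (Fin n → ℚ) → Fin n → ℚ
except a f j = if toℕ a ≡ᵇ toℕ j then 0ℚ else f j

indicator : ∀ {n} → Subset n → Fin n → ℚ
indicator S i = guard (lookup S i) 1ℚ

ΣF≡sum : ∀ n (f : Fin n → ℚ) → ΣF n f ≡ sum f
ΣF≡sum zero    f = refl
ΣF≡sum (suc n) f = cong (f zero +_) (ΣF≡sum n (f ∘ suc))

ΣF-cong : ∀ n {f g : Fin n → ℚ} → (∀ i → f i ≡ g i) → ΣF n f ≡ ΣF n g
ΣF-cong n {f} {g} f≗g = trans (ΣF≡sum n f) (trans (sum-cong-≗ f≗g) (sym (ΣF≡sum n g)))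

ΣF-zero : ∀ n → ΣF n (λ _ → 0ℚ) ≡ 0ℚ
ΣF-zero n = trans (ΣF≡sum n _) (sum-replicate-zero n)

ΣF-distrib-+ : ∀ n (f g : Fin n → ℚ) → ΣF n (λ i → f i + g i) ≡ ΣF n f + ΣF n g
ΣF-distrib-+ n f g = begin
  ΣF n (λ i → f i + g i)  ≡⟨ ΣF≡sum n _ ⟩
  sum (λ i → f i + g i)   ≡⟨ ∑-distrib-+ f g ⟩
  sum f + sum g           ≡⟨ cong₂ _+_ (ΣF≡sum n f) (ΣF≡sum n g) ⟨
  ΣF n f + ΣF n g         ∎
  where open ≡-Reasoning

ΣF-comm : ∀ m n (f : Fin m → Fin n → ℚ) →
          ΣF m (λ i → ΣF n (f i)) ≡ ΣF n (λ j → ΣF m (λ i → f i j))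
ΣF-comm m n f = begin
  ΣF m (λ i → ΣF n (f i))           ≡⟨ ΣF²≡sum² m n f ⟩
  sum (λ i → sum (f i))             ≡⟨ ∑-comm f ⟩
  sum (λ j → sum (λ i → f i j))     ≡⟨ ΣF²≡sum² n m (flip f) ⟨
  ΣF n (λ j → ΣF m (λ i → f i j))  ∎
  where
  open ≡-Reasoning
  ΣF²≡sum² : ∀ m n (f : Fin m → Fin n → ℚ) → ΣF m (λ i → ΣF n (f i)) ≡ sum (λ i → sum (f i))
  ΣF²≡sum² m n f = trans (ΣF≡sum m _) (sum-cong-≗ (λ i → ΣF≡sum n (f i)))

*-distribˡ-ΣF : ∀ n c (f : Fin n → ℚ) → c * ΣF n f ≡ ΣF n (λ i → c * f i)
*-distribˡ-ΣF n c f = begin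
  c * ΣF n f              ≡⟨ cong (c *_) (ΣF≡sum n f) ⟩
  c * sum f               ≡⟨ *-distribˡ-sum c f ⟩
  sum (λ i → c * f i)     ≡⟨ ΣF≡sum n _ ⟨
  ΣF n (λ i → c * f i)    ∎
  where open ≡-Reasoning

ΣF-mono-≤ : ∀ n {f g : Fin n → ℚ} → (∀ i → f i ≤ g i) → ΣF n f ≤ ΣF n g
ΣF-mono-≤ zero    f≤g = ≤-refl
ΣF-mono-≤ (suc n) f≤g = +-mono-≤ (f≤g zero) (ΣF-mono-≤ n (f≤g ∘ suc))

ΣF-except : ∀ n (f : Fin n → ℚ) a → ΣF n f ≡ f a + ΣF n (except a f)
ΣF-except (suc n) f zero    = cong (f zero +_) (sym (+-identityˡ _))
ΣF-except (suc n) f (suc a) = begin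
  f zero + ΣF n (f ∘ suc)                                  ≡⟨ cong (f zero +_) (ΣF-except n (f ∘ suc) a) ⟩
  f zero + (f (suc a) + ΣF n (except a (f ∘ suc)))         ≡⟨ x∙yz≈y∙xz (f zero) (f (suc a)) _ ⟩
  f (suc a) + (f zero + ΣF n (except a (f ∘ suc)))         ∎
  where open ≡-Reasoning

except-self : ∀ {n} (a : Fin n) f → except a f a ≡ 0ℚ
except-self a f with toℕ a ≡ᵇ toℕ a | ≡⇒≡ᵇ (toℕ a) (toℕ a) refl
... | true | _ = refl

except-≢ : ∀ {n} {a j : Fin n} f → a ≢ j → except a f j ≡ f j
except-≢ {a = a} {j} f a≢j with toℕ a ≡ᵇ toℕ j in eq
... | false = refl
... | true  = ⊥-elim (a≢j (toℕ-injective (≡ᵇ⇒≡ (toℕ a) (toℕ j) (subst T (sym eq) tt))))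

except-cong : ∀ {n} (a : Fin n) {f g} → (∀ j → f j ≡ g j) → ∀ j → except a f j ≡ except a g j
except-cong a f≗g j = cong (if toℕ a ≡ᵇ toℕ j then 0ℚ else_) (f≗g j)

except-comm : ∀ {n} (a b : Fin n) f j → except a (except b f) j ≡ except b (except a f) j
except-comm a b f j = if-swap-else (toℕ a ≡ᵇ toℕ j) (toℕ b ≡ᵇ toℕ j)

except-*ˡ : ∀ {n} (a : Fin n) c f j → except a (λ i → c * f i) j ≡ c * except a f j
except-*ˡ a c f j with toℕ a ≡ᵇ toℕ j
... | true  = sym (*-zeroʳ c)
... | false = refl

except-mono-≤ : ∀ {n} (a j : Fin n) {u v} → (a ≢ j → u ≤ v) →
                (if toℕ a ≡ᵇ toℕ j then 0ℚ else u) ≤ (if toℕ a ≡ᵇ toℕ j then 0ℚ else v)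
except-mono-≤ a j u≤v with toℕ a ≡ᵇ toℕ j in eq
... | true  = ≤-refl
... | false = u≤v (λ { refl → subst T eq (≡⇒≡ᵇ (toℕ a) (toℕ a) refl) })

ΣF-indicator : ∀ {n} (S : Subset n) → ΣF n (indicator S) ≡ ι ∣ S ∣
ΣF-indicator []          = refl
ΣF-indicator (true ∷ S)  = trans (cong (1ℚ +_) (ΣF-indicator S)) (sym (ι-suc ∣ S ∣))
ΣF-indicator (false ∷ S) = trans (+-identityˡ _) (ΣF-indicator S)

Σ< : ∀ n → (Fin n → Fin n → ℚ) → ℚ
Σ< n g = ΣF n (λ i → ΣF n (λ j → guard (toℕ i <ᵇ toℕ j) (g i j)))

guard-<ᵇ-+-guard->ᵇ : ∀ m k q → guard (m <ᵇ k) q + guard (k <ᵇ m) q ≡ (if m ≡ᵇ k then 0ℚ else q)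
guard-<ᵇ-+-guard->ᵇ zero    zero    q = refl
guard-<ᵇ-+-guard->ᵇ zero    (suc k) q = ℚP.+-identityʳ q
guard-<ᵇ-+-guard->ᵇ (suc m) zero    q = +-identityˡ q
guard-<ᵇ-+-guard->ᵇ (suc m) (suc k) q = guard-<ᵇ-+-guard->ᵇ m k q

handshake : ∀ n (g : Fin n → Fin n → ℚ) → (∀ i j → g i j ≡ g j i) →
            Σ< n g + Σ< n g ≡ ΣF n (λ i → ΣF n (except i (g i)))
handshake n g g-sym = begin
  Σ< n g + Σ< n g                                            ≡⟨ cong (Σ< n g +_) Σ<≡Σ> ⟩
  Σ< n g + Σ>                                                ≡⟨ ΣF-distrib-+ n _ _ ⟨
  ΣF n (λ i → ΣF n (λ j → guard (toℕ i <ᵇ toℕ j) (g i j))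
            + ΣF n (λ j → guard (toℕ j <ᵇ toℕ i) (g i j)))    ≡⟨ ΣF-cong n (λ i → ΣF-distrib-+ n _ _) ⟨
  ΣF n (λ i → ΣF n (λ j → guard (toℕ i <ᵇ toℕ j) (g i j)
                        + guard (toℕ j <ᵇ toℕ i) (g i j)))   ≡⟨ ΣF-cong n (λ i → ΣF-cong n (λ j →
                                                                 guard-<ᵇ-+-guard->ᵇ (toℕ i) (toℕ j) (g i j))) ⟩
  ΣF n (λ i → ΣF n (except i (g i)))                         ∎
  where
  open ≡-Reasoning
  Σ> : ℚ
  Σ> = ΣF n (λ i → ΣF n (λ j → guard (toℕ j <ᵇ toℕ i) (g i j)))
  Σ<≡Σ> : Σ< n g ≡ Σ>
  Σ<≡Σ> = trans (ΣF-comm n n _) (ΣF-cong n (λ i → ΣF-cong n (λ j → cong (guard _) (g-sym j i))))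

adjacency : ∀ {n} → Subset n → (Fin n → Fin n → Bool) → Fin n → Fin n → ℚ
adjacency S R i j = guard (lookup S i) (guard (lookup S j) (b2q (R i j)))

degree : ∀ {n} → Subset n → (Fin n → Fin n → Bool) → Fin n → ℚ
degree {n} S R i = ΣF n (except i (adjacency S R i))

0≤b2q : ∀ x → 0ℚ ≤ b2q x
0≤b2q true  = ≤-compute
0≤b2q false = ≤-compute

b2q≤1 : ∀ x → b2q x ≤ 1ℚ
b2q≤1 true  = ≤-compute
b2q≤1 false = ≤-compute

b2q-+-≤1 : ∀ x y → (x ≡ true → y ≡ true → ⊥) → b2q x + b2q y ≤ 1ℚ
b2q-+-≤1 true  true  not-both = ⊥-elim (not-both refl refl)
b2q-+-≤1 true  false _        = ≤-compute
b2q-+-≤1 false true  _        = ≤-compute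
b2q-+-≤1 false false _        = ≤-compute

module NonAdjacentPair
  {n : ℕ} {S : Subset n} {R : Fin n → Fin n → Bool}
  (R-sym : ∀ i j → R i j ≡ R j i)
  (R-trans : ∀ {p q r} → p ≢ q → q ≢ r → p ≢ r → R p q ≡ true → R q r ≡ true → R p r ≡ true)
  {a b : Fin n} (a∈S : lookup S a ≡ true) (b∈S : lookup S b ≡ true) (a≢b : a ≢ b) (Rab≡false : R a b ≡ false)
  where

  others : ℚ
  others = ΣF n (except b (except a (indicator S)))

  ι∣S∣≡2+others : ι ∣ S ∣ ≡ 1ℚ + (1ℚ + others)
  ι∣S∣≡2+others = begin
    ι ∣ S ∣                                                  ≡⟨ ΣF-indicator S ⟨
    ΣF n (indicator S)                                       ≡⟨ ΣF-except n _ a ⟩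
    indicator S a + ΣF n (except a (indicator S))            ≡⟨ cong (indicator S a +_) (ΣF-except n _ b) ⟩
    indicator S a + (except a (indicator S) b + others)      ≡⟨ cong (λ v → indicator S a + (v + others))
                                                                     (except-≢ (indicator S) a≢b) ⟩
    indicator S a + (indicator S b + others)                 ≡⟨ cong₂ (λ u v → guard u 1ℚ + (guard v 1ℚ + others))
                                                                      a∈S b∈S ⟩
    1ℚ + (1ℚ + others)                                       ∎
    where open ≡-Reasoning

  adjacency-∈ : ∀ {i j} → lookup S i ≡ true → lookup S j ≡ true → adjacency S R i j ≡ b2q (R i j)
  adjacency-∈ i∈S j∈S rewrite i∈S | j∈S = refl

  adjacency-sym : ∀ i j → adjacency S R i j ≡ adjacency S R j i
  adjacency-sym i j = trans (if-swap-then (lookup S i) (lookup S j))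
                            (cong (guard (lookup S j) ∘ guard (lookup S i) ∘ b2q) (R-sym i j))

  adjacency≤indicator : ∀ i j → adjacency S R i j ≤ indicator S j
  adjacency≤indicator i j with lookup S i | lookup S j
  ... | true  | true  = b2q≤1 (R i j)
  ... | true  | false = ≤-refl
  ... | false | true  = ≤-compute
  ... | false | false = ≤-refl

  adjacent-to-at-most-one : ∀ j → j ≢ a → j ≢ b → b2q (R j a) + b2q (R j b) ≤ 1ℚ
  adjacent-to-at-most-one j j≢a j≢b = b2q-+-≤1 (R j a) (R j b) λ Rja Rjb →
    Bool.not-¬ Rab≡false (R-trans (≢-sym j≢a) j≢b a≢b (trans (R-sym a j) Rja) Rjb)

  adjacency-a+adjacency-b≤indicator : ∀ j → j ≢ a → j ≢ b →
                                      adjacency S R a j + adjacency S R b j ≤ indicator S j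
  adjacency-a+adjacency-b≤indicator j j≢a j≢b rewrite a∈S | b∈S with lookup S j
  ... | true  = subst₂ (λ u v → b2q u + b2q v ≤ 1ℚ) (R-sym j a) (R-sym j b)
                       (adjacent-to-at-most-one j j≢a j≢b)
  ... | false = ≤-compute

  degree-a+degree-b≤others : degree S R a + degree S R b ≤ others
  degree-a+degree-b≤others =
    subst (_≤ others) (ΣF-distrib-+ n _ _) (ΣF-mono-≤ n pointwise)
    where
    pointwise : ∀ j → except a (adjacency S R a) j + except b (adjacency S R b) j
                    ≤ except b (except a (indicator S)) j
    pointwise j with j ≟ a | j ≟ b
    ... | yes refl | _
      rewrite except-self a (adjacency S R a) | except-≢ (adjacency S R b) (≢-sym a≢b)
            | adjacency-∈ b∈S a∈S | R-sym b a | Rab≡false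
            | except-≢ (except a (indicator S)) (≢-sym a≢b) | except-self a (indicator S) = ≤-refl
    ... | no _ | yes refl
      rewrite except-≢ (adjacency S R a) a≢b | except-self b (adjacency S R b)
            | adjacency-∈ a∈S b∈S | Rab≡false | except-self b (except a (indicator S)) = ≤-refl
    ... | no j≢a | no j≢b
      rewrite except-≢ (adjacency S R a) (≢-sym j≢a) | except-≢ (adjacency S R b) (≢-sym j≢b)
            | except-≢ (except a (indicator S)) (≢-sym j≢b) | except-≢ (indicator S) (≢-sym j≢a)
      = adjacency-a+adjacency-b≤indicator j j≢a j≢b

  degree≤others : ∀ {i} → lookup S i ≡ true → a ≢ i → b ≢ i → degree S R i ≤ others
  degree≤others {i} i∈S a≢i b≢i = begin
    ΣF n (except i g)                                            ≡⟨ ΣF-except n _ a ⟩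
    except i g a + ΣF n (except a (except i g))                  ≡⟨ cong (except i g a +_) (ΣF-except n _ b) ⟩
    except i g a + (except a (except i g) b + rest)              ≡⟨ cong₂ (λ u v → u + (v + rest))
                                                                      (except-≢ g (≢-sym a≢i))
                                                                      (trans (except-≢ (except i g) a≢b)
                                                                             (except-≢ g (≢-sym b≢i))) ⟩
    g a + (g b + rest)                                           ≡⟨ ℚP.+-assoc (g a) (g b) rest ⟨
    (g a + g b) + rest                                           ≤⟨ +-mono-≤ ga+gb≤1 rest≤ ⟩
    1ℚ + ΣF n (except i others′)                                 ≡⟨ cong (_+ ΣF n (except i others′))
                                                                         others′-at-i ⟨
    others′ i + ΣF n (except i others′)                          ≡⟨ ΣF-except n others′ i ⟨
    others                                                       ∎
    where
    open ℚP.≤-Reasoning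
    g : Fin n → ℚ
    g = adjacency S R i
    others′ : Fin n → ℚ
    others′ = except b (except a (indicator S))
    rest : ℚ
    rest = ΣF n (except b (except a (except i g)))
    ga+gb≤1 : g a + g b ≤ 1ℚ
    ga+gb≤1 = subst₂ (λ u v → u + v ≤ 1ℚ) (sym (adjacency-∈ i∈S a∈S)) (sym (adjacency-∈ i∈S b∈S))
                     (adjacent-to-at-most-one i (≢-sym a≢i) (≢-sym b≢i))
    rest≤ : rest ≤ ΣF n (except i others′)
    rest≤ = ΣF-mono-≤ n λ j → begin
      except b (except a (except i g)) j  ≡⟨ except-cong b (except-comm a i g) j ⟩
      except b (except i (except a g)) j  ≡⟨ except-comm b i (except a g) j ⟩
      except i (except b (except a g)) j  ≤⟨ except-mono-≤ i j (λ _ → except-mono-≤ b j λ _ →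
                                                 except-mono-≤ a j λ _ → adjacency≤indicator i j) ⟩
      except i others′ j                  ∎
    others′-at-i : others′ i ≡ 1ℚ
    others′-at-i = trans (except-≢ (except a (indicator S)) b≢i)
                         (trans (except-≢ (indicator S) a≢i) (cong (λ u → guard u 1ℚ) i∈S))

  degree-outside : ∀ {i} → lookup S i ≡ false → degree S R i ≡ 0ℚ
  degree-outside {i} i∉S = trans (ΣF-cong n vanishes) (ΣF-zero n)
    where
    vanishes : ∀ j → except i (adjacency S R i) j ≡ 0ℚ
    vanishes j = trans (except-cong i (λ j → cong (λ u → guard u (guard (lookup S j) (b2q (R i j)))) i∉S) j)
                       (Bool.if-eta _)

  degree≤others*indicator : ∀ i → a ≢ i → b ≢ i → degree S R i ≤ others * indicator S i
  degree≤others*indicator i a≢i b≢i with lookup S i Bool.≟ true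
  ... | yes i∈S = ≤-trans (degree≤others i∈S a≢i b≢i)
                          (≤-reflexive (sym (trans (cong (λ u → others * guard u 1ℚ) i∈S) (*-identityʳ others))))
  ... | no  i∉S = ≤-reflexive (trans (degree-outside (Bool.¬-not i∉S))
                                     (sym (trans (cong (λ u → others * guard u 1ℚ) (Bool.¬-not i∉S))
                                                 (*-zeroʳ others))))

  Σdegree≤ : ΣF n (degree S R) ≤ others + others * others
  Σdegree≤ = begin
    ΣF n d                                                   ≡⟨ ΣF-except n d a ⟩
    d a + ΣF n (except a d)                                  ≡⟨ cong (d a +_) (ΣF-except n _ b) ⟩
    d a + (except a d b + rest)                              ≡⟨ cong (λ v → d a + (v + rest)) (except-≢ d a≢b) ⟩
    d a + (d b + rest)                                       ≡⟨ ℚP.+-assoc (d a) (d b) rest ⟨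
    (d a + d b) + rest                                       ≤⟨ +-mono-≤ degree-a+degree-b≤others rest≤ ⟩
    others + ΣF n (except b (except a (λ i → others * indicator S i)))
                                                             ≡⟨ cong (others +_) (ΣF-cong n scale) ⟩
    others + ΣF n (λ i → others * except b (except a (indicator S)) i)
                                                             ≡⟨ cong (others +_) (*-distribˡ-ΣF n others _) ⟨
    others + others * others                                 ∎
    where
    open ℚP.≤-Reasoning
    d : Fin n → ℚ
    d = degree S R
    rest : ℚ
    rest = ΣF n (except b (except a d))
    rest≤ : rest ≤ ΣF n (except b (except a (λ i → others * indicator S i)))
    rest≤ = ΣF-mono-≤ n λ i → except-mono-≤ b i λ b≢i → except-mono-≤ a i λ a≢i →
              degree≤others*indicator i a≢i b≢i
    scale : ∀ i → except b (except a (λ i → others * indicator S i)) i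
                ≡ others * except b (except a (indicator S)) i
    scale i = trans (except-cong b (except-*ˡ a others (indicator S)) i)
                    (except-*ˡ b others (except a (indicator S)) i)

  Σ<-adjacency≤rhs : Σ< n (adjacency S R) ≤ rhs ∣ S ∣
  Σ<-adjacency≤rhs = begin
    Σ< n (adjacency S R)                                  ≡⟨ half (Σ< n (adjacency S R)) ⟩
    (Σ< n (adjacency S R) + Σ< n (adjacency S R)) * ½     ≡⟨ cong (_* ½) (handshake n _ adjacency-sym) ⟩
    ΣF n (degree S R) * ½                                 ≤⟨ *-monoʳ-≤-nonNeg ½ Σdegree≤ ⟩
    (others + others * others) * ½                        ≡⟨ rhs≡ ⟨
    rhs ∣ S ∣                                             ∎
    where
    open ℚP.≤-Reasoning
    half : ∀ x → x ≡ (x + x) * ½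
    half = solve 1 (λ x → x := (x :+ x) :* con ½) refl
    rhs≡ : rhs ∣ S ∣ ≡ (others + others * others) * ½
    rhs≡ = trans (cong (λ t → ((t - 1ℚ) * (t - ι 2)) * ½) ι∣S∣≡2+others)
                 (solve 1 (λ c → let t = con 1ℚ :+ (con 1ℚ :+ c) in
                                 ((t :- con 1ℚ) :* (t :- con (ι 2))) :* con ½ := (c :+ c :* c) :* con ½)
                          refl others)

edge-< : ∀ {n} {A : Set} (x : Fin n → Fin n → A) {i j} → toℕ i ℕ.< toℕ j → edge x i j ≡ x i j
edge-< x {i} {j} i<j with toℕ i <ᵇ toℕ j | <⇒<ᵇ i<j
... | true | _ = refl

edge-> : ∀ {n} {A : Set} (x : Fin n → Fin n → A) {i j} → toℕ j ℕ.< toℕ i → edge x i j ≡ x j i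
edge-> x {i} {j} j<i with toℕ i <ᵇ toℕ j | <ᵇ⇒< (toℕ i) (toℕ j)
... | false | _   = refl
... | true  | i<j = ⊥-elim (<-asym (i<j tt) j<i)

edge-sym : ∀ {n} {A : Set} (x : Fin n → Fin n → A) i j → edge x i j ≡ edge x j i
edge-sym x i j with <-cmp i j
... | tri< i<j _ _    = trans (edge-< x i<j) (sym (edge-> x i<j))
... | tri≈ _ refl _   = refl
... | tri> _ _ j<i    = trans (edge-> x j<i) (sym (edge-< x j<i))

IsClique : ∀ {n} → (Fin n → Fin n → Bool) → Subset n → Set
IsClique R S = ∀ i j → lookup S i ≡ true → lookup S j ≡ true → i ≢ j → R i j ≡ true

TriangleClosed : Bool → Bool → Bool → Set
TriangleClosed x y z = (x ≡ true → y ≡ true → z ≡ true)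
                     × (x ≡ true → z ≡ true → y ≡ true)
                     × (y ≡ true → z ≡ true → x ≡ true)

b2q-two⇒third : ∀ x y z → b2q x + b2q y - b2q z ≤ 1ℚ → x ≡ true → y ≡ true → z ≡ true
b2q-two⇒third true  true  true  _ _ _ = refl
b2q-two⇒third true  true  false 2≤1 _ _ = ⊥-elim (≰-compute 2≤1)
b2q-two⇒third false _     _     _ () _
b2q-two⇒third true  false _     _ _ ()

triangle-inequalities⇒closed : ∀ x y z →
  (b2q x + b2q y - b2q z ≤ 1ℚ) × (b2q x - b2q y + b2q z ≤ 1ℚ) × ((0ℚ - b2q x) + b2q y + b2q z ≤ 1ℚ) →
  TriangleClosed x y z
triangle-inequalities⇒closed x y z (xyz , xzy , yzx) =
    b2q-two⇒third x y z xyz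
  , b2q-two⇒third x z y (subst (_≤ 1ℚ) (swap (b2q x) (b2q y) (b2q z)) xzy)
  , b2q-two⇒third y z x (subst (_≤ 1ℚ) (rotate (b2q x) (b2q y) (b2q z)) yzx)
  where
  swap : ∀ u v w → u - v + w ≡ u + w - v
  swap = solve 3 (λ u v w → u :- v :+ w := u :+ w :- v) refl
  rotate : ∀ u v w → (0ℚ - u) + v + w ≡ v + w - u
  rotate = solve 3 (λ u v w → (con 0ℚ :- u) :+ v :+ w := v :+ w :- u) refl

closed⇒transitive : ∀ {n} {R : Fin n → Fin n → Bool} → (∀ {i j} → R i j ≡ true → R j i ≡ true) →
  (∀ {i j l} → i Fin.< j → j Fin.< l → TriangleClosed (R i j) (R j l) (R i l)) →
  ∀ {p q r} → p ≢ q → q ≢ r → p ≢ r → R p q ≡ true → R q r ≡ true → R p r ≡ true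
closed⇒transitive {R = R} R-flip closed {p} {q} {r} p≢q q≢r p≢r Rpq Rqr
  with <-cmp p q | <-cmp q r | <-cmp p r
... | tri≈ _ p≡q _ | _ | _ = ⊥-elim (p≢q p≡q)
... | _ | tri≈ _ q≡r _ | _ = ⊥-elim (q≢r q≡r)
... | _ | _ | tri≈ _ p≡r _ = ⊥-elim (p≢r p≡r)
... | tri< p<q _ _ | tri< q<r _ _ | _            = proj₁ (closed p<q q<r) Rpq Rqr
... | tri< p<q _ _ | tri> _ _ r<q | tri< p<r _ _ = proj₂ (proj₂ (closed p<r r<q)) (R-flip Rqr) Rpq
... | tri< p<q _ _ | tri> _ _ r<q | tri> _ _ r<p = R-flip (proj₂ (proj₂ (closed r<p p<q)) Rpq (R-flip Rqr))
... | tri> _ _ q<p | tri< q<r _ _ | tri< p<r _ _ = proj₁ (proj₂ (closed q<p p<r)) (R-flip Rpq) Rqr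
... | tri> _ _ q<p | tri< q<r _ _ | tri> _ _ r<p = R-flip (proj₁ (proj₂ (closed q<r r<p)) Rqr (R-flip Rpq))
... | tri> _ _ q<p | tri> _ _ r<q | _            = R-flip (proj₁ (closed r<q q<p) (R-flip Rqr) (R-flip Rpq))

guard-cong : ∀ b {u v} → (T b → u ≡ v) → guard b u ≡ guard b v
guard-cong true  u≡v = u≡v tt
guard-cong false _   = refl

ΣET-cong-< : ∀ {n} (S : Subset n) {x x′ : Fin n → Fin n → ℚ} →
             (∀ i j → toℕ i ℕ.< toℕ j → x i j ≡ x′ i j) → ΣET S x ≡ ΣET S x′
ΣET-cong-< {n} S {x} {x′} x≐x′ = ΣF-cong n λ i → ΣF-cong n λ j →
  cong (guard (lookup S i) ∘ guard (lookup S j)) (guard-cong (toℕ i <ᵇ toℕ j) λ i<ᵇj →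
    let i<j = <ᵇ⇒< (toℕ i) (toℕ j) i<ᵇj in
    trans (edge-< x i<j) (trans (x≐x′ i j i<j) (sym (edge-< x′ i<j))))

ΣET-b2q≡Σ<-adjacency : ∀ {n} (S : Subset n) (y : Fin n → Fin n → Bool) →
                       ΣET S (λ i j → b2q (y i j)) ≡ Σ< n (adjacency S (edge y))
ΣET-b2q≡Σ<-adjacency {n} S y = ΣF-cong n λ i → ΣF-cong n λ j →
  let d = toℕ i <ᵇ toℕ j in begin
    guard (lookup S i) (guard (lookup S j) (guard d (edge (λ i j → b2q (y i j)) i j)))
      ≡⟨ cong (guard (lookup S i) ∘ guard (lookup S j) ∘ guard d) (Bool.if-float b2q d) ⟨
    guard (lookup S i) (guard (lookup S j) (guard d (b2q (edge y i j))))
      ≡⟨ cong (guard (lookup S i)) (if-swap-then (lookup S j) d) ⟩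
    guard (lookup S i) (guard d (guard (lookup S j) (b2q (edge y i j))))
      ≡⟨ if-swap-then (lookup S i) d ⟩
    guard d (adjacency S (edge y) i j)
      ∎
  where open ≡-Reasoning

module _ {A : Set} where

  ΣL-*-zeroʳ : ∀ (ps : List A) (c : A → ℚ) → ΣL ps (λ p → c p * 0ℚ) ≡ 0ℚ
  ΣL-*-zeroʳ []       c = refl
  ΣL-*-zeroʳ (p ∷ ps) c = cong₂ _+_ (*-zeroʳ (c p)) (ΣL-*-zeroʳ ps c)

  ΣL-*ʳ : ∀ (ps : List A) (c : A → ℚ) r → ΣL ps (λ p → c p * r) ≡ ΣL ps c * r
  ΣL-*ʳ []       c r = sym (ℚP.*-zeroˡ r)
  ΣL-*ʳ (p ∷ ps) c r = trans (cong (c p * r +_) (ΣL-*ʳ ps c r)) (sym (ℚP.*-distribʳ-+ r (c p) (ΣL ps c)))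

  ΣL-*-mono-≤ : ∀ {ps : List A} {c f g : A → ℚ} → All (λ p → 0ℚ ≤ c p) ps → (∀ p → f p ≤ g p) →
                ΣL ps (λ p → c p * f p) ≤ ΣL ps (λ p → c p * g p)
  ΣL-*-mono-≤ []                       f≤g = ≤-refl
  ΣL-*-mono-≤ {c = c} (_∷_ {p} cp≥0 cs) f≤g =
    +-mono-≤ (*-monoˡ-≤-nonNeg (c p) {{nonNegative cp≥0}} (f≤g p)) (ΣL-*-mono-≤ cs f≤g)

  convex-combination-≤ : ∀ {ps : List A} {c f : A → ℚ} {r} → All (λ p → 0ℚ ≤ c p) ps → ΣL ps c ≡ 1ℚ →
                         (∀ p → f p ≤ r) → ΣL ps (λ p → c p * f p) ≤ r
  convex-combination-≤ {ps} {c} {f} {r} c≥0 Σc≡1 f≤r = begin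
    ΣL ps (λ p → c p * f p)  ≤⟨ ΣL-*-mono-≤ c≥0 f≤r ⟩
    ΣL ps (λ p → c p * r)    ≡⟨ ΣL-*ʳ ps c r ⟩
    ΣL ps c * r              ≡⟨ cong (_* r) Σc≡1 ⟩
    1ℚ * r                   ≡⟨ *-identityˡ r ⟩
    r                        ∎
    where open ℚP.≤-Reasoning

  guard-ΣL : ∀ b (ps : List A) (c f : A → ℚ) →
             guard b (ΣL ps (λ p → c p * f p)) ≡ ΣL ps (λ p → c p * guard b (f p))
  guard-ΣL true  ps c f = refl
  guard-ΣL false ps c f = sym (ΣL-*-zeroʳ ps c)

  ΣF-ΣL : ∀ n (ps : List A) (c : A → ℚ) (f : A → Fin n → ℚ) →
          ΣF n (λ i → ΣL ps (λ p → c p * f p i)) ≡ ΣL ps (λ p → c p * ΣF n (f p))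
  ΣF-ΣL n []       c f = ΣF-zero n
  ΣF-ΣL n (p ∷ ps) c f = begin
    ΣF n (λ i → c p * f p i + ΣL ps (λ q → c q * f q i))
      ≡⟨ ΣF-distrib-+ n _ _ ⟩
    ΣF n (λ i → c p * f p i) + ΣF n (λ i → ΣL ps (λ q → c q * f q i))
      ≡⟨ cong₂ _+_ (sym (*-distribˡ-ΣF n (c p) (f p))) (ΣF-ΣL n ps c f) ⟩
    c p * ΣF n (f p) + ΣL ps (λ q → c q * ΣF n (f q))
      ∎
    where open ≡-Reasoning

  ΣET-ΣL : ∀ {n} (S : Subset n) (ps : List A) (c : A → ℚ) (f : A → Fin n → Fin n → ℚ) →
           ΣET S (λ i j → ΣL ps (λ p → c p * f p i j)) ≡ ΣL ps (λ p → c p * ΣET S (f p))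
  ΣET-ΣL {n} S ps c f = begin
    ΣET S X                                                ≡⟨ ΣF-cong n (λ i → ΣF-cong n (summand i)) ⟩
    ΣF n (λ i → ΣF n (λ j → ΣL ps (λ p → c p * s p i j)))  ≡⟨ ΣF-cong n (λ i → ΣF-ΣL n ps c (λ p → s p i)) ⟩
    ΣF n (λ i → ΣL ps (λ p → c p * ΣF n (s p i)))          ≡⟨ ΣF-ΣL n ps c (λ p i → ΣF n (s p i)) ⟩
    ΣL ps (λ p → c p * ΣET S (f p))                         ∎
    where
    open ≡-Reasoning
    X : Fin n → Fin n → ℚ
    X i j = ΣL ps (λ p → c p * f p i j)
    s : A → Fin n → Fin n → ℚ
    s p i j = guard (lookup S i) (guard (lookup S j) (guard (toℕ i <ᵇ toℕ j) (edge (f p) i j)))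
    edge-ΣL : ∀ i j → edge X i j ≡ ΣL ps (λ p → c p * edge (f p) i j)
    edge-ΣL i j with toℕ i <ᵇ toℕ j
    ... | true  = refl
    ... | false = refl
    summand : ∀ i j → guard (lookup S i) (guard (lookup S j) (guard (toℕ i <ᵇ toℕ j) (edge X i j)))
                    ≡ ΣL ps (λ p → c p * s p i j)
    summand i j = begin
      guard Si (guard Sj (guard d (edge X i j)))
        ≡⟨ cong (guard Si ∘ guard Sj ∘ guard d) (edge-ΣL i j) ⟩
      guard Si (guard Sj (guard d (ΣL ps (λ p → c p * edge (f p) i j))))
        ≡⟨ cong (guard Si ∘ guard Sj) (guard-ΣL d ps c _) ⟩
      guard Si (guard Sj (ΣL ps (λ p → c p * guard d (edge (f p) i j))))
        ≡⟨ cong (guard Si) (guard-ΣL Sj ps c _) ⟩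
      guard Si (ΣL ps (λ p → c p * guard Sj (guard d (edge (f p) i j))))
        ≡⟨ guard-ΣL Si ps c _ ⟩
      ΣL ps (λ p → c p * s p i j)
        ∎
      where
      Si Sj d : Bool
      Si = lookup S i
      Sj = lookup S j
      d  = toℕ i <ᵇ toℕ j

module _ {n k : ℕ} .{{_ : ℕ.NonZero k}} {w : Fin n → ℚ} {WL WU : ℚ} {y : Fin n → Fin n → Bool}
         (feasible : Feasible n k w WL WU y) (w>0 : ∀ i → 0ℚ < w i) (WU>0 : 0ℚ < WU) where

  feasible⇒transitive : ∀ {p q r} → p ≢ q → q ≢ r → p ≢ r →
                        edge y p q ≡ true → edge y q r ≡ true → edge y p r ≡ true
  feasible⇒transitive = closed⇒transitive (λ {i} {j} → trans (edge-sym y j i)) λ {i} {j} {l} i<j j<l →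
    triangle-inequalities⇒closed _ _ _ (Feasible.triangle feasible i j l i<j j<l)

  clique-weight≤ : (S : Subset n) → IsClique (edge y) S → wt w S ≤ WU
  clique-weight≤ S clique with any? (λ i → lookup S i Bool.≟ true)
  ... | no S-empty = ≤-trans (≤-reflexive wt≡0) (<⇒≤ WU>0)
    where
    wt≡0 : wt w S ≡ 0ℚ
    wt≡0 = trans (ΣF-cong n λ i → cong (λ u → guard u (w i)) (Bool.¬-not (S-empty ∘ (i ,_)))) (ΣF-zero n)
  ... | yes (i , i∈S) = begin
    wt w S                                                ≡⟨ ΣF-except n _ i ⟩
    guard (lookup S i) (w i) + ΣF n (except i wS)         ≡⟨ cong (λ u → guard u (w i) + ΣF n (except i wS)) i∈S ⟩
    w i + ΣF n (except i wS)                              ≤⟨ ℚP.+-monoʳ-≤ (w i) (ΣF-mono-≤ n λ j →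
                                                               except-mono-≤ i j (wS≤ j)) ⟩
    w i + ΣF n (except i (λ j → w j * b2q (edge y i j)))  ≤⟨ Feasible.weightU feasible i ⟩
    WU                                                    ∎
    where
    open ℚP.≤-Reasoning
    wS : Fin n → ℚ
    wS j = guard (lookup S j) (w j)
    wS≤ : ∀ j → i ≢ j → wS j ≤ w j * b2q (edge y i j)
    wS≤ j i≢j with lookup S j Bool.≟ true
    ... | yes j∈S rewrite j∈S | clique i j i∈S j∈S i≢j = ≤-reflexive (sym (*-identityʳ (w j)))
    ... | no  j∉S rewrite Bool.¬-not j∉S =
      ≤-trans (≤-reflexive (sym (*-zeroʳ (w j))))
              (*-monoˡ-≤-nonNeg (w j) {{nonNegative (<⇒≤ (w>0 j))}} (0≤b2q (edge y i j)))

  heavy⇒non-adjacent-pair : (S : Subset n) → WU < wt w S →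
    ∃₂ λ a b → lookup S a ≡ true × lookup S b ≡ true × a ≢ b × edge y a b ≡ false
  heavy⇒non-adjacent-pair S heavy with any? (λ a → any? (λ b →
    (lookup S a Bool.≟ true) ×-dec (lookup S b Bool.≟ true) ×-dec ¬? (a ≟ b) ×-dec (edge y a b Bool.≟ false)))
  ... | yes (a , b , pair) = a , b , pair
  ... | no none = ⊥-elim (<-irrefl refl (<-≤-trans heavy (clique-weight≤ S clique)))
    where
    clique : IsClique (edge y) S
    clique i j i∈S j∈S i≢j = Bool.¬-not λ Rij≡false → none (i , j , i∈S , j∈S , i≢j , Rij≡false)

  integer-point-bound : (S : Subset n) → WU < wt w S → ΣET S (λ i j → b2q (y i j)) ≤ rhs ∣ S ∣
  integer-point-bound S heavy with heavy⇒non-adjacent-pair S heavy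
  ... | a , b , a∈S , b∈S , a≢b , Rab≡false = begin
    ΣET S (λ i j → b2q (y i j))  ≡⟨ ΣET-b2q≡Σ<-adjacency S y ⟩
    Σ< n (adjacency S (edge y))  ≤⟨ Σ<-adjacency≤rhs ⟩
    rhs ∣ S ∣                    ∎
    where
    open ℚP.≤-Reasoning
    open NonAdjacentPair {S = S} (edge-sym y) feasible⇒transitive a∈S b∈S a≢b Rab≡false

proposition1 : (n k : ℕ) .{{_ : ℕ.NonZero k}} → k ≥ 2 → FL n k ≥ 2 →
    (w : Fin n → ℚ) → (∀ i → 0ℚ < w i) →
    (WL WU : ℚ) → 0ℚ < WL → 0ℚ < WU → WL ≤ WU →
    (T : Subset n) → WU < wt w T →
    (x : Fin n → Fin n → ℚ) → In𝒫 n k w WL WU x →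
    ΣET T x ≤ rhs ∣ T ∣
proposition1 n k _ _ w w>0 WL WU _ WU>0 _ S heavy x x∈𝒫 = begin
  ΣET S x                                               ≡⟨ ΣET-cong-< S (In𝒫.combo x∈𝒫) ⟩
  ΣET S (λ i j → ΣL pts (λ p → coeff p * b2q (point p i j)))
                                                        ≡⟨ ΣET-ΣL S pts coeff (λ p i j → b2q (point p i j)) ⟩
  ΣL pts (λ p → coeff p * ΣET S (λ i j → b2q (point p i j)))
                                                        ≤⟨ convex-combination-≤ (In𝒫.nonneg x∈𝒫) (In𝒫.sumOne x∈𝒫)
                                                                                 point-bound ⟩
  rhs ∣ S ∣                                             ∎
  where
  open ℚP.≤-Reasoning
  pts : List (ℚ × FeasiblePt n k w WL WU)
  pts = In𝒫.pts x∈𝒫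
  coeff : ℚ × FeasiblePt n k w WL WU → ℚ
  coeff = proj₁
  point : ℚ × FeasiblePt n k w WL WU → Fin n → Fin n → Bool
  point p = proj₁ (proj₂ p)
  point-bound : ∀ p → ΣET S (λ i j → b2q (point p i j)) ≤ rhs ∣ S ∣
  point-bound p = integer-point-bound (proj₂ (proj₂ p)) w>0 WU>0 S heavy
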